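{- Let $\mathcal{G}=\langle G_1,\dots,G_L\rangle$ be a non-strict temporal graph on a vertex set $V$ of size $n$ in which every layer consists of exactly two components and no two consecutive layers have the same partition. If there are $m\ge 1+\log_2 n$ consecutive free transitions, i.e., the transitions from step $t+j$ to step $t+j+1$ are free for all $j=0,\dots,m-1$, then for every $s\in V$ there is a non-strict exploration schedule starting at $s$.
   Context: A non-strict temporal graph is a sequence of partitions $G_t$ of $V$ (components). A non-strict temporal walk starting at $v$ at time $t_1$ is a sequence of components $C_{t_1},C_{t_1+1},\dots,C_{t_l}$ with $C_t\in G_t$, consecutive components intersecting, and $v\in C_{t_1}$; it visits the union of its components. A non-strict exploration schedule starting at $s$ is such a walk with $t_1=1$ starting at $s$ that visits all of $V$. With $G_j=\{A_j,B_j\}$, $G_{j+1}=\{A_{j+1},B_{j+1}\}$, the transition from step $j$ to $j+1$ is free if $A_j\cap A_{j+1}$, $A_j\cap B_{j+1}$, $B_j\cap A_{j+1}$, $B_j\cap B_{j+1}$ are all non-empty. -}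

module Defs where

open import Data.Nat using (ℕ; zero; suc; _+_; _*_; _^_; _≤_; _<_)
open import Data.Fin using (Fin)
open import Data.Bool using (Bool; true; false; not)
open import Data.Product using (Σ; ∃; _×_; _,_)
open import Data.Sum using (_⊎_)
open import Relation.Binary.PropositionalEquality using (_≡_)
open import Relation.Nullary using (¬_)

-- A layer with (at most) two components on V = Fin n, given by a
-- 2-colouring: the components are {v | c v ≡ true} and {v | c v ≡ false}.
-- The component "labelled b" of layer c is {v | c v ≡ b}.
Layer : ℕ → Set
Layer n = Fin n → Bool

TwoComponents : ∀ {n} → Layer n → Set
TwoComponents c = (∃ λ v → c v ≡ true) × (∃ λ v → c v ≡ false)

SamePartition : ∀ {n} → Layer n → Layer n → Set
SamePartition c d = (∀ v → c v ≡ d v) ⊎ (∀ v → c v ≡ not (d v))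

Free : ∀ {n} → Layer n → Layer n → Set
Free c d = ∀ b b′ → ∃ λ v → (c v ≡ b) × (d v ≡ b′)

-- A non-strict temporal graph ⟨G_1,…,G_L⟩ with two-component layers is
-- given by L and G : ℕ → Layer n, where G i (for i < L) is the paper's
-- layer G_{i+1} (0-indexed times); G i for i ≥ L is irrelevant.

-- A non-strict exploration schedule starting at s: a walk starting at
-- time 0 (paper time 1) of length l (components at times 0,…,l-1, with
-- 1 ≤ l ≤ L), given by the choice w i of component of layer G i, such that
-- s lies in the first component, consecutive components intersect, and
-- every vertex lies in some component of the walk.
ExplorationSchedule : ∀ {n} (L : ℕ) (G : ℕ → Layer n) (s : Fin n) → Set
ExplorationSchedule {n} L G s =
  Σ ℕ λ l → Σ (ℕ → Bool) λ w →
    (1 ≤ l) × (l ≤ L) × (G 0 s ≡ w 0)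
    × (∀ i → suc i < l → ∃ λ v → (G i v ≡ w i) × (G (suc i) v ≡ w (suc i)))
    × (∀ (v : Fin n) → ∃ λ i → (i < l) × (G i v ≡ w i))

-- Follow the component of s up to time t. In the window of m free
-- transitions every component of the next layer is reachable from the
-- current one, so at each step we may enter the side of the layer that
-- contains at least half of the vertices not yet visited; after m halvings
-- fewer than one, hence none, remain.
module Submission where

open import Defs
open import Data.Nat using (ℕ; zero; suc; _+_; _*_; _^_; _∸_; _≤_; _<_; z≤n; s≤s; z<s; s<s; _≤?_)
open import Data.Nat.Properties
open import Data.Fin using (Fin)
import Data.Fin as Fin
open import Data.Bool using (Bool; true; false; not; _∧_; _xor_; if_then_else_)
open import Data.Product using (∃; _×_; _,_)
open import Data.Sum using (_⊎_; inj₁; inj₂)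
open import Function using (_∘_)
open import Relation.Nullary using (¬_; yes; no; contradiction)
open import Relation.Binary.PropositionalEquality

∣_∣ : ∀ {n} → (Fin n → Bool) → ℕ
∣_∣ {zero}  U = 0
∣_∣ {suc n} U = (if U Fin.zero then 1 else 0) + ∣ U ∘ Fin.suc ∣

_∩_ : ∀ {n} → (Fin n → Bool) → (Fin n → Bool) → Fin n → Bool
(U ∩ V) v = U v ∧ V v

∁ : ∀ {n} → (Fin n → Bool) → Fin n → Bool
∁ U v = not (U v)

∣⊤∣≡n : ∀ n → ∣ (λ (_ : Fin n) → true) ∣ ≡ n
∣⊤∣≡n zero    = refl
∣⊤∣≡n (suc n) = cong suc (∣⊤∣≡n n)

∈⇒0<∣∣ : ∀ {n} {U : Fin n → Bool} {v} → U v ≡ true → 0 < ∣ U ∣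
∈⇒0<∣∣ {U = U} {Fin.zero}  U∋v rewrite U∋v = z<s
∈⇒0<∣∣ {U = U} {Fin.suc v} U∋v =
  ≤-trans (∈⇒0<∣∣ {U = U ∘ Fin.suc} U∋v) (m≤n+m _ _)

∣U∣≡∣U∩c∣+∣U∩∁c∣ : ∀ {n} (U c : Fin n → Bool) → ∣ U ∣ ≡ ∣ U ∩ c ∣ + ∣ U ∩ ∁ c ∣
∣U∣≡∣U∩c∣+∣U∩∁c∣ {zero} U c = refl
∣U∣≡∣U∩c∣+∣U∩∁c∣ {suc n} U c with U Fin.zero | c Fin.zero
... | false | _     = ∣U∣≡∣U∩c∣+∣U∩∁c∣ (U ∘ Fin.suc) (c ∘ Fin.suc)
... | true  | true  = cong suc (∣U∣≡∣U∩c∣+∣U∩∁c∣ (U ∘ Fin.suc) (c ∘ Fin.suc))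
... | true  | false = trans (cong suc (∣U∣≡∣U∩c∣+∣U∩∁c∣ (U ∘ Fin.suc) (c ∘ Fin.suc)))
                            (sym (+-suc _ _))

outside : ∀ {n} → Layer n → Bool → Fin n → Bool
outside c b v = b xor c v

inside-or-outside : ∀ {n} (c : Layer n) b v → c v ≡ b ⊎ outside c b v ≡ true
inside-or-outside c b v with c v
inside-or-outside c true  v | true  = inj₁ refl
inside-or-outside c false v | true  = inj₂ refl
inside-or-outside c true  v | false = inj₂ refl
inside-or-outside c false v | false = inj₁ refl

∩-intro : ∀ {n} {U V : Fin n → Bool} {v} → U v ≡ true → V v ≡ true → (U ∩ V) v ≡ true
∩-intro U∋v V∋v rewrite U∋v | V∋v = refl

2*m≡m+m : ∀ m → 2 * m ≡ m + m
2*m≡m+m m = cong (m +_) (+-identityʳ m)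

outside-≤-half : ∀ {n} (U : Fin n → Bool) (c : Layer n) →
  ∃ λ b → 2 * ∣ U ∩ outside c b ∣ ≤ ∣ U ∣
outside-≤-half U c with ∣ U ∩ c ∣ ≤? ∣ U ∩ ∁ c ∣
... | yes a≤b = false , (begin
  2 * ∣ U ∩ c ∣             ≡⟨ 2*m≡m+m ∣ U ∩ c ∣ ⟩
  ∣ U ∩ c ∣ + ∣ U ∩ c ∣     ≤⟨ +-monoʳ-≤ ∣ U ∩ c ∣ a≤b ⟩
  ∣ U ∩ c ∣ + ∣ U ∩ ∁ c ∣   ≡⟨ sym (∣U∣≡∣U∩c∣+∣U∩∁c∣ U c) ⟩
  ∣ U ∣                     ∎)
  where open ≤-Reasoning
... | no a≰b = true , (begin
  2 * ∣ U ∩ ∁ c ∣           ≡⟨ 2*m≡m+m ∣ U ∩ ∁ c ∣ ⟩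
  ∣ U ∩ ∁ c ∣ + ∣ U ∩ ∁ c ∣ ≤⟨ +-monoˡ-≤ ∣ U ∩ ∁ c ∣ (<⇒≤ (≰⇒> a≰b)) ⟩
  ∣ U ∩ c ∣ + ∣ U ∩ ∁ c ∣   ≡⟨ sym (∣U∣≡∣U∩c∣+∣U∩∁c∣ U c) ⟩
  ∣ U ∣                     ∎)
  where open ≤-Reasoning

Covers : ∀ {n} (H : ℕ → Layer n) (m : ℕ) (w : ℕ → Bool) (U : Fin n → Bool) → Set
Covers H m w U = ∀ v → U v ≡ true → ∃ λ j → (j < m) × (H j v ≡ w j)

halving-cover : ∀ {n} m (H : ℕ → Layer n) (U : Fin n → Bool) →
  2 * ∣ U ∣ ≤ 2 ^ m → ∃ λ w → Covers H m w U
halving-cover zero H U 2∣U∣≤1 = (λ _ → false) , λ v U∋v →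
  contradiction (≤-trans (*-monoʳ-≤ 2 (∈⇒0<∣∣ {U = U} U∋v)) 2∣U∣≤1) λ { (s≤s ()) }
halving-cover (suc m) H U 2∣U∣≤2^1+m
  with b , half ← outside-≤-half U (H 0)
  with w , covers ← halving-cover m (H ∘ suc) (U ∩ outside (H 0) b)
                      (≤-trans half (*-cancelˡ-≤ 2 2∣U∣≤2^1+m))
  = b∷w , covers-U
  where
  b∷w : ℕ → Bool
  b∷w zero    = b
  b∷w (suc j) = w j
  covers-U : Covers H (suc m) b∷w U
  covers-U v U∋v with inside-or-outside (H 0) b v
  ... | inj₁ in-b = 0 , z<s , in-b
  ... | inj₂ out  with j , j<m , eq ← covers v (∩-intro {U = U} {outside (H 0) b} U∋v out)
    = suc j , s<s j<m , eq

splice : {A : Set} → ℕ → (ℕ → A) → (ℕ → A) → ℕ → A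
splice t f g i with i ≤? t
... | yes _ = f i
... | no  _ = g (i ∸ suc t)

splice-≤ : ∀ {A : Set} {t} (f g : ℕ → A) {i} → i ≤ t → splice t f g i ≡ f i
splice-≤ {t = t} f g {i} i≤t with i ≤? t
... | yes _   = refl
... | no  i≰t = contradiction i≤t i≰t

splice-suc-+ : ∀ {A : Set} t (f g : ℕ → A) j → splice t f g (suc t + j) ≡ g j
splice-suc-+ t f g j with suc t + j ≤? t
... | yes 1+t+j≤t = contradiction (m+n≤o⇒m≤o (suc t) 1+t+j≤t) 1+n≰n
... | no  _       = cong g (m+n∸m≡n (suc t) j)

module _ {n} (G : ℕ → Layer n) where

  Consecutive : ℕ → (ℕ → Bool) → Set
  Consecutive l w = ∀ i → suc i < l → ∃ λ v → (G i v ≡ w i) × (G (suc i) v ≡ w (suc i))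

  stay-then : Fin n → ℕ → (ℕ → Bool) → ℕ → Bool
  stay-then s t = splice t (λ i → G i s)

  stay-then-≤ : ∀ s {t} w {i} → i ≤ t → stay-then s t w i ≡ G i s
  stay-then-≤ s w = splice-≤ (λ i → G i s) w

  stay-then-consecutive : ∀ s t m w →
    (∀ j → j < m → Free (G (t + j)) (G (suc (t + j)))) →
    Consecutive (suc (t + m)) (stay-then s t w)
  stay-then-consecutive s t m w free i (s≤s 1+i≤t+m) with t ≤? i
  ... | no  t≰i = s , sym (stay-then-≤ s w (<⇒≤ (≰⇒> t≰i))) , sym (stay-then-≤ s w (≰⇒> t≰i))
  ... | yes t≤i with j , refl ← m≤n⇒∃[o]m+o≡n t≤i
    with v , in-current , in-next ← free j (+-cancelˡ-< t j m 1+i≤t+m) (stay-then s t w (t + j)) (w j)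
    = v , in-current , trans in-next (sym (splice-suc-+ t (λ i → G i s) w j))

  stay-then-visits : ∀ s t m w → Covers (λ j → G (suc t + j)) m w (λ _ → true) →
    ∀ v → ∃ λ i → (i < suc (t + m)) × (G i v ≡ stay-then s t w i)
  stay-then-visits s t m w covers v with j , j<m , eq ← covers v refl =
    suc t + j , s<s (+-monoʳ-< t j<m) , trans eq (sym (splice-suc-+ t (λ i → G i s) w j))

lemma27 : (n L : ℕ) (G : ℕ → Layer n)
    → (∀ i → i < L → TwoComponents (G i))
    → (∀ i → suc i < L → ¬ SamePartition (G i) (G (suc i)))
    → (t m : ℕ)
    → 2 * n ≤ 2 ^ m
    → t + m < L
    → (∀ j → j < m → Free (G (t + j)) (G (suc (t + j))))
    → (s : Fin n) → ExplorationSchedule L G s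
lemma27 n L G _ _ t m 2n≤2^m t+m<L free s
  with w , covers ← halving-cover m (λ j → G (suc t + j)) (λ _ → true)
                      (subst (λ k → 2 * k ≤ 2 ^ m) (sym (∣⊤∣≡n n)) 2n≤2^m)
  = suc (t + m) , stay-then G s t w , s≤s z≤n , t+m<L , sym (stay-then-≤ G s {t} w z≤n)
  , stay-then-consecutive G s t m w free , stay-then-visits G s t m w covers
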